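{- Let $n\ge 1$ and let $p=(p_1,\dots,p_n)$, $q=(q_1,\dots,q_n)$ be real vectors of variables. Let $P,Q$ be the real cyclic Hankel $n\times n$ matrices defined by $P_{ij}=p_{k(i,j)}$, $Q_{ij}=q_{k(i,j)}$, where $k(i,j)=((i+j-2)\bmod n)+1$ (so the first row is indexed $1,2,\dots,n$, the second row $2,3,\dots,n,1$, etc.). Then the Böttcher–Wenzel form \[ BW=2\Big(\|P\|^2\|Q\|^2-\mathrm{trace}^2(P^TQ)\Big)-\|PQ-QP\|^2 \] (Frobenius norm) is a sum of squares of real polynomials in the variables $p_1,\dots,p_n,q_1,\dots,q_n$.
   Context: A polynomial is a sum of squares (sos) if it is a finite sum of squares of real polynomials. -}

module Defs where

open import Level using (Level; _⊔_) renaming (suc to lsuc)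
open import Algebra.Bundles using (CommutativeRing)
open import Data.Nat as ℕ using (ℕ; zero; suc)
open import Data.Nat.DivMod using (_%_; m%n<n)
open import Data.Fin using (Fin; toℕ; fromℕ<)
import Data.Fin as F
open import Data.Sum using (_⊎_; inj₁; inj₂)
open import Data.Product using (Σ; _×_; ∃)
open import Data.List using (List; []; _∷_)
open import Relation.Nullary using (¬_)

-- The real numbers, axiomatised as a complete ordered field
-- (the standard library has no ℝ; any model of this record is
-- isomorphic to ℝ).

record RealField (c ℓ : Level) : Set (lsuc (c ⊔ ℓ)) where
  field
    commRing : CommutativeRing c ℓ
  open CommutativeRing commRing public
  field
    _<_        : Carrier → Carrier → Set ℓ
    <-irrefl   : ∀ {x} → ¬ (x < x)
    <-trans    : ∀ {x y z} → x < y → y < z → x < z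
    <-trichot  : ∀ x y → (x < y) ⊎ ((x ≈ y) ⊎ (y < x))
    <-resp-≈   : ∀ {x x′ y y′} → x ≈ x′ → y ≈ y′ → x < y → x′ < y′
    +-mono-<   : ∀ {x y} z → x < y → (x + z) < (y + z)
    *-pos      : ∀ {x y} → 0# < x → 0# < y → 0# < (x * y)
    0<1        : 0# < 1#
    inv        : ∀ x → ¬ (x ≈ 0#) → Σ Carrier λ y → (x * y) ≈ 1#
    lub        : (S : Carrier → Set ℓ) → Σ Carrier S →
                 Σ Carrier (λ b → ∀ x → S x → (x < b) ⊎ (x ≈ b)) →
                 Σ Carrier λ s →
                   (∀ x → S x → (x < s) ⊎ (x ≈ s)) ×
                   (∀ b → (∀ x → S x → (x < b) ⊎ (x ≈ b)) → (s < b) ⊎ (s ≈ b))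

module _ {c ℓ} (ℝ : RealField c ℓ) where
  open RealField ℝ

  data Poly (V : Set) : Set c where
    con : Carrier → Poly V
    var : V → Poly V
    _⊕_ : Poly V → Poly V → Poly V
    _⊗_ : Poly V → Poly V → Poly V

  ⟦_⟧ : ∀ {V} → Poly V → (V → Carrier) → Carrier
  ⟦ con a ⟧ ρ = a
  ⟦ var v ⟧ ρ = ρ v
  ⟦ f ⊕ g ⟧ ρ = ⟦ f ⟧ ρ + ⟦ g ⟧ ρ
  ⟦ f ⊗ g ⟧ ρ = ⟦ f ⟧ ρ * ⟦ g ⟧ ρ

  sumSq : ∀ {V} → List (Poly V) → (V → Carrier) → Carrier
  sumSq []       ρ = 0#
  sumSq (g ∷ gs) ρ = (⟦ g ⟧ ρ * ⟦ g ⟧ ρ) + sumSq gs ρ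

  -- A polynomial function F is a sum of squares of real polynomials.
  -- (ℝ is infinite, so equality of polynomial functions is equality
  -- of polynomials.)
  IsSOS : ∀ {V} → ((V → Carrier) → Carrier) → Set (c ⊔ ℓ)
  IsSOS {V} F = Σ (List (Poly V)) λ gs → ∀ ρ → F ρ ≈ sumSq gs ρ

  Mat : ℕ → Set c
  Mat n = Fin n → Fin n → Carrier

  Σᶠ : ∀ n → (Fin n → Carrier) → Carrier
  Σᶠ zero    f = 0#
  Σᶠ (suc n) f = f F.zero + Σᶠ n (λ i → f (F.suc i))

  _·_ : ∀ {n} → Mat n → Mat n → Mat n
  _·_ {n} A B i j = Σᶠ n λ k → A i k * B k j

  _⊖_ : ∀ {n} → Mat n → Mat n → Mat n
  (A ⊖ B) i j = A i j - B i j

  transpose : ∀ {n} → Mat n → Mat n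
  transpose A i j = A j i

  trace : ∀ {n} → Mat n → Carrier
  trace {n} A = Σᶠ n λ i → A i i

  ‖_‖² : ∀ {n} → Mat n → Carrier
  ‖_‖² {n} A = Σᶠ n λ i → Σᶠ n λ j → A i j * A i j

  -- 0-indexed cyclic index: k(i,j) = (i + j) mod n, which is the
  -- paper's ((i+j-2) mod n)+1 after shifting all indices by one.
  kidx : ∀ m → Fin (suc m) → Fin (suc m) → Fin (suc m)
  kidx m i j = fromℕ< (m%n<n (toℕ i ℕ.+ toℕ j) (suc m))

  cycHankel : ∀ m → (Fin (suc m) → Carrier) → Mat (suc m)
  cycHankel m p i j = p (kidx m i j)

  BW : ∀ m → (Fin (suc m) ⊎ Fin (suc m) → Carrier) → Carrier
  BW m ρ =
    ((1# + 1#) * ((‖ P ‖² * ‖ Q ‖²) - (trace (transpose P · Q) * trace (transpose P · Q))))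
      - ‖ (P · Q) ⊖ (Q · P) ‖²
    where
    P = cycHankel m (λ i → ρ (inj₁ i))
    Q = cycHankel m (λ i → ρ (inj₂ i))

module Submission where

-- Write P_ij = p(i+j), Q_ij = q(i+j) with indices in ℤ/n, and let
-- minor a b = p_a q_b - q_a p_b.  The proof is a chain of exact identities.
--  * ‖P‖² = n Σ p², ‖Q‖² = n Σ q² and trace(PᵀQ) = n Σ pq, because every
--    residue a ∈ ℤ/n occurs exactly n times as i + j.
--  * (PQ - QP)_ij = Σ_k y_ijk with y_ijk = minor (i+k) (k+j); for fixed k the
--    map (i, j) ↦ (i+k, k+j) is a bijection, so Σ_{i,j} y_ijk² = W := Σ_{a,b} minor².
--  * Lagrange's identity for two vectors gives 2(‖P‖²‖Q‖² - tr²(PᵀQ)) = n² W.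
--  * Lagrange's identity for one vector, n Σ_k y_k² = (Σ_k y_k)² + Σ_{k<l} (y_k - y_l)²,
--    summed over (i, j), gives n² W = ‖PQ - QP‖² + Σ_{i,j} Σ_{k<l} (y_ijk - y_ijl)².
-- Hence BW = Σ_{i,j} Σ_{k<l} (y_ijk - y_ijl)², and each y_ijk - y_ijl is a
-- polynomial in p, q.

open import Defs
open import Algebra.Bundles using (CommutativeRing)
open import Data.Nat as ℕ using (ℕ; zero; suc)
import Data.Nat.Properties as ℕ
open import Data.Nat.DivMod using (_%_; m%n<n; %-distribˡ-+; m%n%n≡m%n; m<n⇒m%n≡m; n%n≡0)
open import Data.Fin using (Fin; toℕ; fromℕ<) renaming (zero to fzero; suc to fsuc)
open import Data.Fin.Properties using (toℕ-fromℕ<; toℕ-injective; toℕ<n)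
open import Data.Fin.Permutation using (Permutation; permutation)
open import Data.List using (List; []; _∷_; _++_; tabulate; concat)
open import Data.Sum using (_⊎_; inj₁; inj₂)
open import Data.Product using (_,_)
open import Relation.Binary.PropositionalEquality as ≡ using (_≡_)
import Algebra.Properties.Ring as RingProperties
import Algebra.Properties.Group as GroupProperties
import Algebra.Properties.Semiring.Sum as SemiringSum
import Algebra.Properties.Semiring.Mult as SemiringMult
import Algebra.Solver.Ring.NaturalCoefficients.Default as NatSolver
import Relation.Binary.Reasoning.Setoid as SetoidReasoning

-- The ring solver used has natural-number coefficients,
-- so negation enters its equations through the variable u = -1.
module CommRingIdentities {c ℓ} (R : CommutativeRing c ℓ) where
  open CommutativeRing R
  open RingProperties ring using (-1*x≈-x; x[y-z]≈xy-xz) public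
  open GroupProperties +-group using (⁻¹-involutive; //-rightDividesʳ)
  open SemiringSum semiring public
    using (sum; sum-syntax; sum-cong-≋; sum-cong-≗; ∑-distrib-+; ∑-comm; ∑-permute; *-distribˡ-sum; *-distribʳ-sum; sum-replicate)
  open SemiringMult semiring using (_×_; ×-congʳ; ×-assoc-*) public
  open NatSolver commutativeSemiring using (solve; _:+_; _:*_; con; _:=_)
  open SetoidReasoning setoid

  two : Carrier
  two = 1# + 1#

  sq : Carrier → Carrier
  sq x = x * x

  x+y-y≈x : ∀ b d → (b + d) - d ≈ b
  x+y-y≈x b d = //-rightDividesʳ d b

  -- (-1)² = 1, a fact about u = -1 that the solver cannot see.
  -1*-1≈1 : (- 1#) * (- 1#) ≈ 1#
  -1*-1≈1 = trans (-1*x≈-x (- 1#)) (⁻¹-involutive 1#)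

  square-of-difference : ∀ a b → sq (a - b) + two * (a * b) ≈ sq a + sq b
  square-of-difference a b = begin
    sq (a - b) + two * (a * b)
      ≈⟨ +-congʳ (*-cong a-b a-b) ⟩
    sq (a + u * b) + two * (a * b)
      ≈⟨ solve 3 (λ a b u → (a :+ u :* b) :* (a :+ u :* b) :+ (con 2 :* (a :* b))
                   := a :* a :+ (u :* u) :* (b :* b) :+ (con 1 :+ u) :* (con 2 :* (a :* b))) refl a b u ⟩
    sq a + (u * u) * sq b + (1# + u) * (two * (a * b))
      ≈⟨ +-cong (+-congˡ (trans (*-congʳ -1*-1≈1) (*-identityˡ (sq b))))
                (trans (*-congʳ (-‿inverseʳ 1#)) (zeroˡ _)) ⟩
    sq a + sq b + 0#
      ≈⟨ +-identityʳ _ ⟩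
    sq a + sq b ∎
    where
    u = - 1#
    a-b : a - b ≈ a + u * b
    a-b = +-congˡ (sym (-1*x≈-x b))

  ∑-const : ∀ k a → ∑[ i < k ] a ≈ (k × 1#) * a
  ∑-const k a = begin
    ∑[ i < k ] a       ≈⟨ sum-replicate k ⟩
    k × a              ≈⟨ ×-congʳ k (sym (*-identityˡ a)) ⟩
    k × (1# * a)       ≈⟨ ×-assoc-* k 1# a ⟨
    (k × 1#) * a       ∎

  ∑-distrib-neg : ∀ k (f : Fin k → Carrier) → ∑[ i < k ] (- f i) ≈ - sum f
  ∑-distrib-neg k f = begin
    ∑[ i < k ] (- f i)          ≈⟨ sum-cong-≋ (λ i → -1*x≈-x (f i)) ⟨
    ∑[ i < k ] (- 1# * f i)     ≈⟨ *-distribˡ-sum (- 1#) f ⟨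
    - 1# * sum f                ≈⟨ -1*x≈-x (sum f) ⟩
    - sum f                     ∎

  ∑-distrib-sub : ∀ k (f g : Fin k → Carrier) → ∑[ i < k ] (f i - g i) ≈ sum f - sum g
  ∑-distrib-sub k f g = trans (∑-distrib-+ f (λ i → - g i)) (+-congˡ (∑-distrib-neg k g))

  ∑-product : ∀ k l (f : Fin k → Carrier) (g : Fin l → Carrier) →
              ∑[ i < k ] ∑[ j < l ] (f i * g j) ≈ sum f * sum g
  ∑-product k l f g = begin
    ∑[ i < k ] ∑[ j < l ] (f i * g j)  ≈⟨ sum-cong-≋ (λ i → *-distribˡ-sum (f i) g) ⟨
    ∑[ i < k ] (f i * sum g)           ≈⟨ *-distribʳ-sum (sum g) f ⟨
    sum f * sum g                      ∎

  ∑²-distrib-+ : ∀ k l (F G : Fin k → Fin l → Carrier) →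
    ∑[ i < k ] ∑[ j < l ] (F i j + G i j) ≈ ∑[ i < k ] ∑[ j < l ] F i j + ∑[ i < k ] ∑[ j < l ] G i j
  ∑²-distrib-+ k l F G =
    trans (sum-cong-≋ (λ i → ∑-distrib-+ (F i) (G i))) (∑-distrib-+ (λ i → sum (F i)) (λ i → sum (G i)))

  *-distribˡ-∑² : ∀ k l x (F : Fin k → Fin l → Carrier) →
    x * ∑[ i < k ] ∑[ j < l ] F i j ≈ ∑[ i < k ] ∑[ j < l ] (x * F i j)
  *-distribˡ-∑² k l x F =
    trans (*-distribˡ-sum x (λ i → sum (F i))) (sum-cong-≋ (λ i → *-distribˡ-sum x (F i)))

  pairwiseSq : ∀ k → (Fin k → Carrier) → Carrier
  pairwiseSq zero    x = 0#
  pairwiseSq (suc k) x = ∑[ l < k ] sq (x fzero - x (fsuc l)) + pairwiseSq k (λ i → x (fsuc i))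

  lagrange-variance : ∀ k (x : Fin k → Carrier) →
    (k × 1#) * ∑[ i < k ] sq (x i) ≈ sq (sum x) + pairwiseSq k x
  lagrange-variance zero    x = sym (+-identityʳ _)
  lagrange-variance (suc k) x = begin
    (1# + N) * (sq a + S₂)
      ≈⟨ solve 3 (λ N a S₂ → (con 1 :+ N) :* (a :* a :+ S₂)
                     := a :* a :+ N :* S₂ :+ (N :* (a :* a) :+ S₂)) refl N a S₂ ⟩
    sq a + N * S₂ + (N * sq a + S₂)
      ≈⟨ +-cong (+-congˡ (lagrange-variance k x′)) (sym cross) ⟩
    sq a + (sq S₁ + D′) + (D + two * (a * S₁))
      ≈⟨ solve 4 (λ a S₁ D D′ → a :* a :+ (S₁ :* S₁ :+ D′) :+ (D :+ con 2 :* (a :* S₁))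
                      := (a :+ S₁) :* (a :+ S₁) :+ (D :+ D′)) refl a S₁ D D′ ⟩
    sq (a + S₁) + (D + D′) ∎
    where
    a  = x fzero
    x′ = λ i → x (fsuc i)
    N  = k × 1#
    S₁ = sum x′
    S₂ = ∑[ i < k ] sq (x′ i)
    D  = ∑[ l < k ] sq (a - x′ l)
    D′ = pairwiseSq k x′
    cross : D + two * (a * S₁) ≈ N * sq a + S₂
    cross = begin
      D + two * (a * S₁)                          ≈⟨ +-congˡ (*-congˡ (*-distribˡ-sum a x′)) ⟩
      D + two * ∑[ l < k ] (a * x′ l)             ≈⟨ +-congˡ (*-distribˡ-sum two (λ l → a * x′ l)) ⟩
      D + ∑[ l < k ] (two * (a * x′ l))           ≈⟨ ∑-distrib-+ (λ l → sq (a - x′ l)) (λ l → two * (a * x′ l)) ⟨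
      ∑[ l < k ] (sq (a - x′ l) + two * (a * x′ l)) ≈⟨ sum-cong-≋ (λ l → square-of-difference a (x′ l)) ⟩
      ∑[ l < k ] (sq a + sq (x′ l))               ≈⟨ ∑-distrib-+ (λ _ → sq a) (λ l → sq (x′ l)) ⟩
      ∑[ l < k ] sq a + S₂                        ≈⟨ +-congʳ (∑-const k (sq a)) ⟩
      N * sq a + S₂                               ∎

  lagrange-identity : ∀ k (p q : Fin k → Carrier) →
    ∑[ a < k ] ∑[ b < k ] sq (p a * q b - q a * p b) + two * sq (∑[ a < k ] (p a * q a))
      ≈ two * (∑[ a < k ] sq (p a) * ∑[ b < k ] sq (q b))
  lagrange-identity k p q = begin
    ∑∑ (λ a b → sq (u a b - v a b)) + two * sq Spq
      ≈⟨ +-congˡ cross ⟩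
    ∑∑ (λ a b → sq (u a b - v a b)) + ∑∑ (λ a b → two * (u a b * v a b))
      ≈⟨ ∑²-distrib-+ k k (λ a b → sq (u a b - v a b)) (λ a b → two * (u a b * v a b)) ⟨
    ∑∑ (λ a b → sq (u a b - v a b) + two * (u a b * v a b))
      ≈⟨ sum-cong-≋ (λ a → sum-cong-≋ (λ b → square-of-difference (u a b) (v a b))) ⟩
    ∑∑ (λ a b → sq (u a b) + sq (v a b))
      ≈⟨ sum-cong-≋ (λ a → sum-cong-≋ (λ b → solve 4 (λ pa qa pb qb →
            (pa :* qb) :* (pa :* qb) :+ (qa :* pb) :* (qa :* pb)
              := (pa :* pa) :* (qb :* qb) :+ (qa :* qa) :* (pb :* pb)) refl (p a) (q a) (p b) (q b))) ⟩
    ∑∑ (λ a b → sq (p a) * sq (q b) + sq (q a) * sq (p b))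
      ≈⟨ ∑²-distrib-+ k k (λ a b → sq (p a) * sq (q b)) (λ a b → sq (q a) * sq (p b)) ⟩
    ∑∑ (λ a b → sq (p a) * sq (q b)) + ∑∑ (λ a b → sq (q a) * sq (p b))
      ≈⟨ +-cong (∑-product k k (λ a → sq (p a)) (λ b → sq (q b))) (∑-product k k (λ a → sq (q a)) (λ b → sq (p b))) ⟩
    Spp * Sqq + Sqq * Spp
      ≈⟨ solve 2 (λ x y → x :* y :+ y :* x := con 2 :* (x :* y)) refl Spp Sqq ⟩
    two * (Spp * Sqq) ∎
    where
    ∑∑ : (Fin k → Fin k → Carrier) → Carrier
    ∑∑ F = ∑[ a < k ] ∑[ b < k ] F a b
    u v : Fin k → Fin k → Carrier
    u a b = p a * q b
    v a b = q a * p b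
    Spp = ∑[ a < k ] sq (p a)
    Sqq = ∑[ b < k ] sq (q b)
    Spq = ∑[ a < k ] (p a * q a)
    cross : two * sq Spq ≈ ∑∑ (λ a b → two * (u a b * v a b))
    cross = begin
      two * sq Spq                                    ≈⟨ *-congˡ (∑-product k k (λ a → p a * q a) (λ b → p b * q b)) ⟨
      two * ∑∑ (λ a b → (p a * q a) * (p b * q b))    ≈⟨ *-distribˡ-∑² k k two (λ a b → (p a * q a) * (p b * q b)) ⟩
      ∑∑ (λ a b → two * ((p a * q a) * (p b * q b)))  ≈⟨ sum-cong-≋ (λ a → sum-cong-≋ (λ b → *-congˡ (solve 4 (λ pa qa pb qb →
                                                            (pa :* qa) :* (pb :* qb) := (pa :* qb) :* (qa :* pb)) refl (p a) (q a) (p b) (q b)))) ⟩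
      ∑∑ (λ a b → two * (u a b * v a b))              ∎

module CyclicIndex (m : ℕ) where
  open ≡ using (trans; cong)
  open ≡.≡-Reasoning

  n : ℕ
  n = suc m

  infixl 6 _⊞_
  _⊞_ : Fin n → Fin n → Fin n
  i ⊞ j = fromℕ< (m%n<n (toℕ i ℕ.+ toℕ j) n)

  toℕ-⊞ : ∀ i j → toℕ (i ⊞ j) ≡ (toℕ i ℕ.+ toℕ j) % n
  toℕ-⊞ i j = toℕ-fromℕ< _

  %-absorbˡ : ∀ a b → (a % n ℕ.+ b) % n ≡ (a ℕ.+ b) % n
  %-absorbˡ a b = begin
    (a % n ℕ.+ b) % n            ≡⟨ %-distribˡ-+ (a % n) b n ⟩
    (a % n % n ℕ.+ b % n) % n    ≡⟨ cong (λ t → (t ℕ.+ b % n) % n) (m%n%n≡m%n a n) ⟩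
    (a % n ℕ.+ b % n) % n        ≡⟨ %-distribˡ-+ a b n ⟨
    (a ℕ.+ b) % n                ∎

  %-absorbʳ : ∀ a b → (a ℕ.+ b % n) % n ≡ (a ℕ.+ b) % n
  %-absorbʳ a b = begin
    (a ℕ.+ b % n) % n   ≡⟨ cong (_% n) (ℕ.+-comm a (b % n)) ⟩
    (b % n ℕ.+ a) % n   ≡⟨ %-absorbˡ b a ⟩
    (b ℕ.+ a) % n       ≡⟨ cong (_% n) (ℕ.+-comm b a) ⟩
    (a ℕ.+ b) % n       ∎

  ⊞-comm : ∀ i j → i ⊞ j ≡ j ⊞ i
  ⊞-comm i j = toℕ-injective (begin
    toℕ (i ⊞ j)                 ≡⟨ toℕ-⊞ i j ⟩
    (toℕ i ℕ.+ toℕ j) % n       ≡⟨ cong (_% n) (ℕ.+-comm (toℕ i) (toℕ j)) ⟩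
    (toℕ j ℕ.+ toℕ i) % n       ≡⟨ toℕ-⊞ j i ⟨
    toℕ (j ⊞ i)                 ∎)

  ⊞-assoc : ∀ i j k → (i ⊞ j) ⊞ k ≡ i ⊞ (j ⊞ k)
  ⊞-assoc i j k = toℕ-injective (begin
    toℕ ((i ⊞ j) ⊞ k)                         ≡⟨ toℕ-⊞ (i ⊞ j) k ⟩
    (toℕ (i ⊞ j) ℕ.+ toℕ k) % n               ≡⟨ cong (λ t → (t ℕ.+ toℕ k) % n) (toℕ-⊞ i j) ⟩
    ((toℕ i ℕ.+ toℕ j) % n ℕ.+ toℕ k) % n     ≡⟨ %-absorbˡ (toℕ i ℕ.+ toℕ j) (toℕ k) ⟩
    (toℕ i ℕ.+ toℕ j ℕ.+ toℕ k) % n           ≡⟨ cong (_% n) (ℕ.+-assoc (toℕ i) (toℕ j) (toℕ k)) ⟩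
    (toℕ i ℕ.+ (toℕ j ℕ.+ toℕ k)) % n         ≡⟨ %-absorbʳ (toℕ i) (toℕ j ℕ.+ toℕ k) ⟨
    (toℕ i ℕ.+ (toℕ j ℕ.+ toℕ k) % n) % n     ≡⟨ cong (λ t → (toℕ i ℕ.+ t) % n) (toℕ-⊞ j k) ⟨
    (toℕ i ℕ.+ toℕ (j ⊞ k)) % n               ≡⟨ toℕ-⊞ i (j ⊞ k) ⟨
    toℕ (i ⊞ (j ⊞ k))                         ∎)

  ⊞-identityʳ : ∀ i → i ⊞ fzero ≡ i
  ⊞-identityʳ i = toℕ-injective (begin
    toℕ (i ⊞ fzero)        ≡⟨ toℕ-⊞ i fzero ⟩
    (toℕ i ℕ.+ 0) % n      ≡⟨ cong (_% n) (ℕ.+-identityʳ (toℕ i)) ⟩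
    toℕ i % n              ≡⟨ m<n⇒m%n≡m (toℕ<n i) ⟩
    toℕ i                  ∎)

  ⊟_ : Fin n → Fin n
  ⊟ k = fromℕ< (m%n<n (n ℕ.∸ toℕ k) n)

  ⊞-inverseʳ : ∀ k → k ⊞ (⊟ k) ≡ fzero
  ⊞-inverseʳ k = toℕ-injective (begin
    toℕ (k ⊞ (⊟ k))                           ≡⟨ toℕ-⊞ k (⊟ k) ⟩
    (toℕ k ℕ.+ toℕ (⊟ k)) % n                 ≡⟨ cong (λ t → (toℕ k ℕ.+ t) % n) (toℕ-fromℕ< _) ⟩
    (toℕ k ℕ.+ (n ℕ.∸ toℕ k) % n) % n         ≡⟨ %-absorbʳ (toℕ k) (n ℕ.∸ toℕ k) ⟩
    (toℕ k ℕ.+ (n ℕ.∸ toℕ k)) % n             ≡⟨ cong (_% n) (ℕ.m+[n∸m]≡n (ℕ.<⇒≤ (toℕ<n k))) ⟩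
    n % n                                     ≡⟨ n%n≡0 n ⟩
    0                                         ∎)

  rotation : Fin n → Permutation n n
  rotation k = permutation (_⊞ k) (_⊞ (⊟ k)) (cancel (⊟ k) k inverseˡ) (cancel k (⊟ k) (⊞-inverseʳ k))
    where
    inverseˡ : (⊟ k) ⊞ k ≡ fzero
    inverseˡ = trans (⊞-comm (⊟ k) k) (⊞-inverseʳ k)
    cancel : ∀ a b → a ⊞ b ≡ fzero → ∀ i → (i ⊞ a) ⊞ b ≡ i
    cancel a b a⊞b≡0 i = trans (⊞-assoc i a b) (trans (cong (i ⊞_) a⊞b≡0) (⊞-identityʳ i))

module CyclicHankel {c ℓ} (ℝ : RealField c ℓ) (m : ℕ) where
  open RealField ℝ
  open CommRingIdentities commRing
  open CyclicIndex m
  open NatSolver commutativeSemiring using (solve; _:+_; _:*_; con; _:=_)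
  open SetoidReasoning setoid

  Σᶠ≡∑ : ∀ k (f : Fin k → Carrier) → Σᶠ ℝ k f ≡ sum f
  Σᶠ≡∑ zero    f = ≡.refl
  Σᶠ≡∑ (suc k) f = ≡.cong (f fzero +_) (Σᶠ≡∑ k (λ i → f (fsuc i)))

  Σᶠ²≡∑² : ∀ (F : Fin n → Fin n → Carrier) →
           Σᶠ ℝ n (λ i → Σᶠ ℝ n (F i)) ≡ ∑[ i < n ] ∑[ j < n ] F i j
  Σᶠ²≡∑² F = ≡.trans (Σᶠ≡∑ n (λ i → Σᶠ ℝ n (F i))) (sum-cong-≗ (λ i → Σᶠ≡∑ n (F i)))

  N : Carrier
  N = n × 1#

  ∑-rotate : ∀ k (f : Fin n → Carrier) → ∑[ i < n ] f (i ⊞ k) ≈ sum f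
  ∑-rotate k f = sym (∑-permute f (rotation k))

  -- A function of i + j, summed over all pairs, sees every residue n times.
  ∑²-cyclic : ∀ (g : Fin n → Carrier) → ∑[ i < n ] ∑[ j < n ] g (j ⊞ i) ≈ N * sum g
  ∑²-cyclic g = trans (sum-cong-≋ (λ i → ∑-rotate i g)) (∑-const n (sum g))

  ∑²-rotate : ∀ k (F : Fin n → Fin n → Carrier) →
              ∑[ i < n ] ∑[ j < n ] F (i ⊞ k) (j ⊞ k) ≈ ∑[ i < n ] ∑[ j < n ] F i j
  ∑²-rotate k F = trans (sum-cong-≋ (λ i → ∑-rotate k (F (i ⊞ k)))) (∑-rotate k (λ a → sum (F a)))

  normSq-cycHankel : ∀ p → ‖_‖² ℝ (cycHankel ℝ m p) ≈ N * ∑[ a < n ] sq (p a)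
  normSq-cycHankel p = begin
    ‖_‖² ℝ (cycHankel ℝ m p)                  ≡⟨ Σᶠ²≡∑² (λ i j → sq (p (i ⊞ j))) ⟩
    ∑[ i < n ] ∑[ j < n ] sq (p (i ⊞ j))      ≈⟨ ∑-comm (λ i j → sq (p (i ⊞ j))) ⟩
    ∑[ j < n ] ∑[ i < n ] sq (p (i ⊞ j))      ≈⟨ ∑²-cyclic (λ a → sq (p a)) ⟩
    N * ∑[ a < n ] sq (p a)                   ∎

  trace-cycHankel : ∀ p q →
    trace ℝ (_·_ ℝ (transpose ℝ (cycHankel ℝ m p)) (cycHankel ℝ m q)) ≈ N * ∑[ a < n ] (p a * q a)
  trace-cycHankel p q = trans (reflexive (Σᶠ²≡∑² (λ i k → p (k ⊞ i) * q (k ⊞ i))))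
                              (∑²-cyclic (λ a → p a * q a))

  module Commutator (p q : Fin n → Carrier) where
    P Q : Mat ℝ n
    P = cycHankel ℝ m p
    Q = cycHankel ℝ m q

    minor : Fin n → Fin n → Carrier
    minor a b = p a * q b - q a * p b

    W : Carrier
    W = ∑[ a < n ] ∑[ b < n ] sq (minor a b)

    -- The k-th term P_ik Q_kj - Q_ik P_kj of the (i, j) entry of PQ - QP
    -- is the minor at (i+k, k+j).
    y : Fin n → Fin n → Fin n → Carrier
    y i j k = minor (i ⊞ k) (k ⊞ j)

    commutator-entry : ∀ i j → _⊖_ ℝ (_·_ ℝ P Q) (_·_ ℝ Q P) i j ≈ ∑[ k < n ] y i j k
    commutator-entry i j = begin
      Σᶠ ℝ n (λ k → P i k * Q k j) - Σᶠ ℝ n (λ k → Q i k * P k j)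
        ≡⟨ ≡.cong₂ _-_ (Σᶠ≡∑ n (λ k → P i k * Q k j)) (Σᶠ≡∑ n (λ k → Q i k * P k j)) ⟩
      ∑[ k < n ] (P i k * Q k j) - ∑[ k < n ] (Q i k * P k j)
        ≈⟨ ∑-distrib-sub n (λ k → P i k * Q k j) (λ k → Q i k * P k j) ⟨
      ∑[ k < n ] y i j k ∎

    commutator-normSq : ‖_‖² ℝ (_⊖_ ℝ (_·_ ℝ P Q) (_·_ ℝ Q P)) ≈ ∑[ i < n ] ∑[ j < n ] sq (∑[ k < n ] y i j k)
    commutator-normSq = trans (reflexive (Σᶠ²≡∑² (λ i j → sq (_⊖_ ℝ (_·_ ℝ P Q) (_·_ ℝ Q P) i j))))
      (sum-cong-≋ (λ i → sum-cong-≋ (λ j → *-cong (commutator-entry i j) (commutator-entry i j))))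

    -- For fixed k, the terms y i j k run through all the minors exactly once.
    slice : ∀ k → ∑[ i < n ] ∑[ j < n ] sq (y i j k) ≈ W
    slice k = begin
      ∑[ i < n ] ∑[ j < n ] sq (minor (i ⊞ k) (k ⊞ j))
        ≡⟨ sum-cong-≗ (λ i → sum-cong-≗ (λ j → ≡.cong (λ t → sq (minor (i ⊞ k) t)) (⊞-comm k j))) ⟩
      ∑[ i < n ] ∑[ j < n ] sq (minor (i ⊞ k) (j ⊞ k))
        ≈⟨ ∑²-rotate k (λ a b → sq (minor a b)) ⟩
      W ∎

    slices-lagrange : N * (N * W) ≈ ∑[ i < n ] ∑[ j < n ] sq (∑[ k < n ] y i j k)
                                    + ∑[ i < n ] ∑[ j < n ] pairwiseSq n (y i j)
    slices-lagrange = begin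
      N * (N * W)                                          ≈⟨ *-congˡ (∑-const n W) ⟨
      N * ∑[ k < n ] W                                     ≈⟨ *-congˡ (sum-cong-≋ slice) ⟨
      N * ∑[ k < n ] ∑[ i < n ] ∑[ j < n ] sq (y i j k)    ≈⟨ *-congˡ (∑-comm (λ k i → ∑[ j < n ] sq (y i j k))) ⟩
      N * ∑[ i < n ] ∑[ k < n ] ∑[ j < n ] sq (y i j k)    ≈⟨ *-congˡ (sum-cong-≋ (λ i → ∑-comm (λ k j → sq (y i j k)))) ⟩
      N * ∑[ i < n ] ∑[ j < n ] ∑[ k < n ] sq (y i j k)    ≈⟨ *-distribˡ-∑² n n N (λ i j → ∑[ k < n ] sq (y i j k)) ⟩
      ∑[ i < n ] ∑[ j < n ] (N * ∑[ k < n ] sq (y i j k))  ≈⟨ sum-cong-≋ (λ i → sum-cong-≋ (λ j → lagrange-variance n (y i j))) ⟩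
      ∑[ i < n ] ∑[ j < n ] (sq (∑[ k < n ] y i j k) + pairwiseSq n (y i j))
        ≈⟨ ∑²-distrib-+ n n (λ i j → sq (∑[ k < n ] y i j k)) (λ i j → pairwiseSq n (y i j)) ⟩
      ∑[ i < n ] ∑[ j < n ] sq (∑[ k < n ] y i j k) + ∑[ i < n ] ∑[ j < n ] pairwiseSq n (y i j) ∎

    gram : two * (‖_‖² ℝ P * ‖_‖² ℝ Q)
           ≈ N * (N * W) + two * sq (trace ℝ (_·_ ℝ (transpose ℝ P) Q))
    gram = begin
      two * (‖_‖² ℝ P * ‖_‖² ℝ Q)
        ≈⟨ *-congˡ (*-cong (normSq-cycHankel p) (normSq-cycHankel q)) ⟩
      two * ((N * Spp) * (N * Sqq))
        ≈⟨ solve 3 (λ N x y → con 2 :* ((N :* x) :* (N :* y)) := (N :* N) :* (con 2 :* (x :* y))) refl N Spp Sqq ⟩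
      (N * N) * (two * (Spp * Sqq))
        ≈⟨ *-congˡ (lagrange-identity n p q) ⟨
      (N * N) * (W + two * sq Spq)
        ≈⟨ solve 3 (λ N W z → (N :* N) :* (W :+ con 2 :* (z :* z)) := N :* (N :* W) :+ con 2 :* ((N :* z) :* (N :* z))) refl N W Spq ⟩
      N * (N * W) + two * sq (N * Spq)
        ≈⟨ +-congˡ (*-congˡ (*-cong tr tr)) ⟨
      N * (N * W) + two * sq (trace ℝ (_·_ ℝ (transpose ℝ P) Q)) ∎
      where
      Spp = ∑[ a < n ] sq (p a)
      Sqq = ∑[ a < n ] sq (q a)
      Spq = ∑[ a < n ] (p a * q a)
      tr = trace-cycHankel p q

    bw-defect : two * (‖_‖² ℝ P * ‖_‖² ℝ Q - sq (trace ℝ (_·_ ℝ (transpose ℝ P) Q)))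
                  - ‖_‖² ℝ (_⊖_ ℝ (_·_ ℝ P Q) (_·_ ℝ Q P))
                ≈ ∑[ i < n ] ∑[ j < n ] pairwiseSq n (y i j)
    bw-defect = begin
      two * (‖_‖² ℝ P * ‖_‖² ℝ Q - T) - ‖_‖² ℝ (_⊖_ ℝ (_·_ ℝ P Q) (_·_ ℝ Q P))
        ≈⟨ +-cong (x[y-z]≈xy-xz two _ T) (-‿cong commutator-normSq) ⟩
      (two * (‖_‖² ℝ P * ‖_‖² ℝ Q) - two * T) - Z
        ≈⟨ +-congʳ (trans (+-congʳ gram) (x+y-y≈x (N * (N * W)) (two * T))) ⟩
      N * (N * W) - Z
        ≈⟨ +-congʳ (trans slices-lagrange (+-comm Z D)) ⟩
      (D + Z) - Z
        ≈⟨ x+y-y≈x D Z ⟩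
      D ∎
      where
      T = sq (trace ℝ (_·_ ℝ (transpose ℝ P) Q))
      Z = ∑[ i < n ] ∑[ j < n ] sq (∑[ k < n ] y i j k)
      D = ∑[ i < n ] ∑[ j < n ] pairwiseSq n (y i j)

module SumsOfSquares {c ℓ} (ℝ : RealField c ℓ) {V : Set} where
  open RealField ℝ
  open CommRingIdentities commRing

  _⊝_ : Poly ℝ V → Poly ℝ V → Poly ℝ V
  f ⊝ g = _⊕_ f (_⊗_ (con (- 1#)) g)

  ⟦⊝⟧ : ∀ f g ρ → ⟦_⟧ ℝ (f ⊝ g) ρ ≈ ⟦_⟧ ℝ f ρ - ⟦_⟧ ℝ g ρ
  ⟦⊝⟧ f g ρ = +-congˡ (-1*x≈-x (⟦_⟧ ℝ g ρ))

  sumSq-++ : ∀ (gs hs : List (Poly ℝ V)) ρ → sumSq ℝ (gs ++ hs) ρ ≈ sumSq ℝ gs ρ + sumSq ℝ hs ρ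
  sumSq-++ []       hs ρ = sym (+-identityˡ _)
  sumSq-++ (g ∷ gs) hs ρ = trans (+-congˡ (sumSq-++ gs hs ρ)) (sym (+-assoc _ _ _))

  sumSq-tabulate : ∀ k (g : Fin k → Poly ℝ V) ρ → sumSq ℝ (tabulate g) ρ ≈ ∑[ i < k ] sq (⟦_⟧ ℝ (g i) ρ)
  sumSq-tabulate zero    g ρ = refl
  sumSq-tabulate (suc k) g ρ = +-congˡ (sumSq-tabulate k (λ i → g (fsuc i)) ρ)

  sumSq-concat : ∀ k (G : Fin k → List (Poly ℝ V)) ρ →
                 sumSq ℝ (concat (tabulate G)) ρ ≈ ∑[ i < k ] sumSq ℝ (G i) ρ
  sumSq-concat zero    G ρ = refl
  sumSq-concat (suc k) G ρ =
    trans (sumSq-++ (G fzero) (concat (tabulate (λ i → G (fsuc i)))) ρ)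
          (+-congˡ (sumSq-concat k (λ i → G (fsuc i)) ρ))

  pairDiffs : ∀ k → (Fin k → Poly ℝ V) → List (Poly ℝ V)
  pairDiffs zero    g = []
  pairDiffs (suc k) g = tabulate (λ l → g fzero ⊝ g (fsuc l)) ++ pairDiffs k (λ i → g (fsuc i))

  sumSq-pairDiffs : ∀ k (g : Fin k → Poly ℝ V) (x : Fin k → Carrier) ρ →
    (∀ i → ⟦_⟧ ℝ (g i) ρ ≈ x i) → sumSq ℝ (pairDiffs k g) ρ ≈ pairwiseSq k x
  sumSq-pairDiffs zero    g x ρ gx = refl
  sumSq-pairDiffs (suc k) g x ρ gx = trans (sumSq-++ diffs (pairDiffs k (λ i → g (fsuc i))) ρ)
    (+-cong (trans (sumSq-tabulate k (λ l → g fzero ⊝ g (fsuc l)) ρ) (sum-cong-≋ diff≈))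
            (sumSq-pairDiffs k (λ i → g (fsuc i)) (λ i → x (fsuc i)) ρ (λ i → gx (fsuc i))))
    where
    diffs = tabulate (λ l → g fzero ⊝ g (fsuc l))
    diff≈ : ∀ l → sq (⟦_⟧ ℝ (g fzero ⊝ g (fsuc l)) ρ) ≈ sq (x fzero - x (fsuc l))
    diff≈ l = let d = trans (⟦⊝⟧ (g fzero) (g (fsuc l)) ρ) (+-cong (gx fzero) (-‿cong (gx (fsuc l))))
              in *-cong d d

module Certificate {c ℓ} (ℝ : RealField c ℓ) (m : ℕ) where
  open RealField ℝ
  open CommRingIdentities commRing
  open CyclicIndex m
  open CyclicHankel.Commutator ℝ m using (minor; y)
  open SumsOfSquares ℝ {Fin n ⊎ Fin n}
  open SetoidReasoning setoid

  Var : Set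
  Var = Fin n ⊎ Fin n

  p q : (Var → Carrier) → Fin n → Carrier
  p ρ a = ρ (inj₁ a)
  q ρ a = ρ (inj₂ a)

  Minor : Fin n → Fin n → Poly ℝ Var
  Minor a b = _⊗_ (var (inj₁ a)) (var (inj₂ b)) ⊝ _⊗_ (var (inj₂ a)) (var (inj₁ b))

  ⟦Minor⟧ : ∀ ρ a b → ⟦_⟧ ℝ (Minor a b) ρ ≈ minor (p ρ) (q ρ) a b
  ⟦Minor⟧ ρ a b = ⟦⊝⟧ (_⊗_ (var (inj₁ a)) (var (inj₂ b))) (_⊗_ (var (inj₂ a)) (var (inj₁ b))) ρ

  Y : Fin n → Fin n → Fin n → Poly ℝ Var
  Y i j k = Minor (i ⊞ k) (k ⊞ j)

  squares : List (Poly ℝ Var)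
  squares = concat (tabulate (λ i → concat (tabulate (λ j → pairDiffs n (Y i j)))))

  sumSq-squares : ∀ ρ → sumSq ℝ squares ρ ≈ ∑[ i < n ] ∑[ j < n ] pairwiseSq n (y (p ρ) (q ρ) i j)
  sumSq-squares ρ = begin
    sumSq ℝ squares ρ
      ≈⟨ sumSq-concat n (λ i → concat (tabulate (λ j → pairDiffs n (Y i j)))) ρ ⟩
    ∑[ i < n ] sumSq ℝ (concat (tabulate (λ j → pairDiffs n (Y i j)))) ρ
      ≈⟨ sum-cong-≋ (λ i → sumSq-concat n (λ j → pairDiffs n (Y i j)) ρ) ⟩
    ∑[ i < n ] ∑[ j < n ] sumSq ℝ (pairDiffs n (Y i j)) ρ
      ≈⟨ sum-cong-≋ (λ i → sum-cong-≋ (λ j →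
           sumSq-pairDiffs n (Y i j) (y (p ρ) (q ρ) i j) ρ (λ k → ⟦Minor⟧ ρ (i ⊞ k) (k ⊞ j)))) ⟩
    ∑[ i < n ] ∑[ j < n ] pairwiseSq n (y (p ρ) (q ρ) i j) ∎

theorem2 : ∀ {c ℓ} (ℝ : RealField c ℓ) (m : ℕ) → IsSOS ℝ (BW ℝ m)
theorem2 ℝ m = squares , λ ρ → trans (bw-defect (p ρ) (q ρ)) (sym (sumSq-squares ρ))
  where
  open RealField ℝ using (trans; sym)
  open CyclicHankel.Commutator ℝ m using (bw-defect)
  open Certificate ℝ m
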